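{- Let $K$ and $K'$ be quadratic fields such that the set $\{N_{K/\mathbb{Q}}(\alpha):\alpha\in\mathcal{O}_K\}$ equals the set $\{N_{K'/\mathbb{Q}}(\alpha'):\alpha'\in\mathcal{O}_{K'}\}$. Then $K=K'$.
   Context: $\mathcal{O}_K$ denotes the ring of integers of $K$, and $N_{K/\mathbb{Q}}$ denotes the field norm. -}

module Defs where

open import Data.Nat as ℕ using (ℕ)
open import Data.Nat.Divisibility as ℕD using ()
open import Data.Integer using (ℤ; +_; _+_; _-_; _*_; ∣_∣)
open import Data.Integer.DivMod using (_/_; _%ℕ_)
open import Data.Product using (Σ; _×_; ∃-syntax)
open import Relation.Binary.PropositionalEquality using (_≡_; _≢_)
open import Relation.Nullary using (¬_)
open import Data.Nat using (_≟_)
open import Relation.Nullary.Decidable using (does)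
open import Data.Bool using (if_then_else_)

-- An integer d is squarefree: the only n ∈ ℕ with n² ∣ d is n = 1.
-- (n = 0 is excluded as well, since 0 ∣ d forces d = 0.)
SquareFree : ℤ → Set
SquareFree d = ∀ (n : ℕ) → (n ℕ.* n) ℕD.∣ ∣ d ∣ → n ≡ 1

-- Quadratic fields are exactly Q(√d) for d squarefree, d ≠ 1
-- (distinct such d give distinct fields). We represent the quadratic
-- field K by this d.
QuadraticFieldParam : ℤ → Set
QuadraticFieldParam d = SquareFree d × d ≢ + 1

-- Ring of integers O_K = ℤ[ω] with ω = (1+√d)/2 if d ≡ 1 (mod 4),
-- ω = √d otherwise. Field norm N_{K/Q}(a + bω):
--   d ≡ 1 (mod 4):  a² + ab + b²·(1-d)/4
--   otherwise:      a² - d b²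
normOK : ℤ → ℤ → ℤ → ℤ
normOK d a b =
  if does ((d %ℕ 4) ≟ 1)
  then a * a + a * b + b * b * ((+ 1 - d) / (+ 4))
  else a * a - d * b * b

IsNormOK : ℤ → ℤ → Set
IsNormOK d n = ∃[ a ] ∃[ b ] normOK d a b ≡ n

-- Write ω for the generator of O_K, K = ℚ(√d), so that 4·N(x + yω) = X² − dY² for suitable
-- integers X, Y, and every a² − db² is itself a norm.  The norm sets then see three invariants
-- of d: its sign (−d is a norm from ℚ(√d), while norms from imaginary fields are ≥ 0); its odd
-- prime divisors (if an odd prime p divides d′ but not d, then every residue mod p is some
-- a² − db², hence a d′-norm, and 4 times a d′-norm is X² − d′Y² ≡ X² mod p; as 4 is a unit,
-- every residue would be a square mod p, which fails for odd p); and the prime 2 (for odd d, the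
-- d-norm 9 − 4d = N(3 + 2√d) is ≡ 5 mod 8, a value x² − 2dy² never takes).  For squarefree d, d′
-- the odd-prime invariant forces |d| / gcd(|d|, |d′|) and |d′| / gcd(|d|, |d′|) into {1, 2}, so
-- |d| and |d′| agree up to a factor 2, and the other two invariants leave only d = d′.
module Submission where

open import Data.Bool using (if_then_else_)
open import Data.Empty using (⊥; ⊥-elim)
open import Data.Fin as Fin using (Fin; toℕ; fromℕ<; splitAt; join)
import Data.Fin.Properties as Fin
open import Data.Integer as ℤ
  using (ℤ; +_; -[1+_]; 0ℤ; _+_; _-_; _*_; -_; ∣_∣; _⊖_; sign; _◃_)
import Data.Integer.Properties as ℤ
open import Data.Integer.DivMod
  using (_/_; _%_; _%ℕ_; _/ℕ_; a≡a%ℕn+[a/ℕn]*n; a≡a%n+[a/n]*n; n%ℕd<d; n%d<d)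
open import Data.Integer.Divisibility.Signed
open import Data.Integer.Tactic.RingSolver using (solve-∀)
open import Data.List using ([]; _∷_)
open import Data.List.Relation.Unary.All using (_∷_)
open import Data.Nat as ℕ using (ℕ; zero; suc; _≤_; _<_; s≤s; z≤n; _∸_)
import Data.Nat.Divisibility as ℕ
open import Data.Nat.GCD using (gcd; gcd[m,n]∣m; gcd[m,n]∣n; gcd-greatest; gcd-comm)
open import Data.Nat.ListAction using (product)
open import Data.Nat.Primality using (Prime; euclidsLemma; ¬prime[1]; prime⇒irreducible)
open import Data.Nat.Primality.Factorisation using (PrimeFactorisation; factorise)
import Data.Nat.Properties as ℕ
open import Data.Product using (∃-syntax; _×_; _,_; proj₁; proj₂)
import Data.Sign.Properties as Sign
open import Data.Sum as Sum using (_⊎_; inj₁; inj₂; [_,_])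
open import Data.Unit using (tt)
open import Function using (_∘_)
open import Level using (0ℓ)
open import Relation.Binary.Bundles using (Setoid)
open import Relation.Binary.PropositionalEquality
  using (_≡_; _≢_; refl; sym; trans; cong; cong₂; subst; module ≡-Reasoning)
import Relation.Binary.Reasoning.Setoid as ≈-Reasoning
open import Relation.Nullary using (¬_; Dec; yes; no; contradiction)
open import Relation.Nullary.Decidable using (dec-true; dec-false; map′; toWitness; _⊎-dec_; ¬?)
open import Relation.Unary using (_⊆_)

open import Defs

-- Congruences of integers

∣⇒≡0 : ∀ {m n} → m ℕ.∣ n → n < m → n ≡ 0
∣⇒≡0 {n = zero}  _   _   = refl
∣⇒≡0 {n = suc n} m∣n n<m = contradiction m∣n (ℕ.>⇒∤ n<m)

∣[+m]-[+n]∣≡∣m-n∣ : ∀ m n → ∣ + m - + n ∣ ≡ ℕ.∣ m - n ∣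
∣[+m]-[+n]∣≡∣m-n∣ zero    zero    = refl
∣[+m]-[+n]∣≡∣m-n∣ zero    (suc n) = refl
∣[+m]-[+n]∣≡∣m-n∣ (suc m) zero    = ℕ.+-identityʳ (suc m)
∣[+m]-[+n]∣≡∣m-n∣ (suc m) (suc n) = begin
  ∣ suc m ⊖ suc n ∣ ≡⟨ cong ∣_∣ (ℤ.[1+m]⊖[1+n]≡m⊖n m n) ⟩
  ∣ m ⊖ n ∣         ≡⟨ cong ∣_∣ (ℤ.[+m]-[+n]≡m⊖n m n) ⟨
  ∣ + m - + n ∣     ≡⟨ ∣[+m]-[+n]∣≡∣m-n∣ m n ⟩
  ℕ.∣ m - n ∣       ∎
  where open ≡-Reasoning

infix 4 _≡_mod_

-- A record rather than a synonym for + m ∣ a - b, so that a and b can be inferred.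
record _≡_mod_ (a b : ℤ) (m : ℕ) : Set where
  constructor ≡-mod
  field
    ∣-difference : + m ∣ a - b

open _≡_mod_

≡-mod? : ∀ a b m → Dec (a ≡ b mod m)
≡-mod? a b m = map′ ≡-mod ∣-difference (+ m ∣? a - b)

module _ {m : ℕ} where

  ≡⇒≡-mod : ∀ {a b} → a ≡ b → a ≡ b mod m
  ≡⇒≡-mod {a} refl = ≡-mod (divides 0ℤ (ℤ.+-inverseʳ a))

  ≡-mod-refl : ∀ a → a ≡ a mod m
  ≡-mod-refl a = ≡⇒≡-mod refl

  ≡-mod-sym : ∀ {a b} → a ≡ b mod m → b ≡ a mod m
  ≡-mod-sym {a} {b} (≡-mod m∣a-b) = ≡-mod (subst (+ m ∣_) (swap a b) (∣m⇒∣-m m∣a-b))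
    where
    swap : ∀ a b → - (a - b) ≡ b - a
    swap = solve-∀

  ≡-mod-trans : ∀ {a b c} → a ≡ b mod m → b ≡ c mod m → a ≡ c mod m
  ≡-mod-trans {a} {b} {c} (≡-mod m∣a-b) (≡-mod m∣b-c) =
    ≡-mod (subst (+ m ∣_) (telescope a b c) (∣m∣n⇒∣m+n m∣a-b m∣b-c))
    where
    telescope : ∀ a b c → (a - b) + (b - c) ≡ a - c
    telescope = solve-∀

  ≡-mod-setoid : Setoid 0ℓ 0ℓ
  ≡-mod-setoid = record
    { Carrier       = ℤ
    ; _≈_           = λ a b → a ≡ b mod m
    ; isEquivalence = record { refl = ≡-mod-refl _ ; sym = ≡-mod-sym ; trans = ≡-mod-trans }
    }

  +-cong-mod : ∀ {a a′ b b′} → a ≡ a′ mod m → b ≡ b′ mod m → a + b ≡ a′ + b′ mod m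
  +-cong-mod {a} {a′} {b} {b′} (≡-mod m∣a-a′) (≡-mod m∣b-b′) =
    ≡-mod (subst (+ m ∣_) (regroup a a′ b b′) (∣m∣n⇒∣m+n m∣a-a′ m∣b-b′))
    where
    regroup : ∀ a a′ b b′ → (a - a′) + (b - b′) ≡ (a + b) - (a′ + b′)
    regroup = solve-∀

  neg-cong-mod : ∀ {a a′} → a ≡ a′ mod m → - a ≡ - a′ mod m
  neg-cong-mod {a} {a′} (≡-mod m∣a-a′) = ≡-mod (subst (+ m ∣_) (regroup a a′) (∣m⇒∣-m m∣a-a′))
    where
    regroup : ∀ a a′ → - (a - a′) ≡ - a - - a′
    regroup = solve-∀

  minus-cong-mod : ∀ {a a′ b b′} → a ≡ a′ mod m → b ≡ b′ mod m → a - b ≡ a′ - b′ mod m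
  minus-cong-mod a≡a′ b≡b′ = +-cong-mod a≡a′ (neg-cong-mod b≡b′)

  *-cong-mod : ∀ {a a′ b b′} → a ≡ a′ mod m → b ≡ b′ mod m → a * b ≡ a′ * b′ mod m
  *-cong-mod {a} {a′} {b} {b′} (≡-mod m∣a-a′) (≡-mod m∣b-b′) =
    ≡-mod (subst (+ m ∣_) (regroup a a′ b b′) (∣m∣n⇒∣m+n (∣n⇒∣m*n b m∣a-a′) (∣n⇒∣m*n a′ m∣b-b′)))
    where
    regroup : ∀ a a′ b b′ → b * (a - a′) + a′ * (b - b′) ≡ a * b - a′ * b′
    regroup = solve-∀

≡-mod⇒≡ : ∀ {m i j} → i < m → j < m → + i ≡ + j mod m → i ≡ j
≡-mod⇒≡ {m} {i} {j} i<m j<m (≡-mod m∣i-j) =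
  ℕ.∣m-n∣≡0⇒m≡n (∣⇒≡0 m∣∣i-j∣ (ℕ.≤-<-trans (ℕ.∣m-n∣≤m⊔n i j) (ℕ.⊔-pres-<m i<m j<m)))
  where
  m∣∣i-j∣ : m ℕ.∣ ℕ.∣ i - j ∣
  m∣∣i-j∣ = subst (m ℕ.∣_) (∣[+m]-[+n]∣≡∣m-n∣ i j) (∣⇒∣ᵤ m∣i-j)

≡-mod-neg-complement : ∀ {m t} → t ≤ m → + t ≡ - + (m ∸ t) mod m
≡-mod-neg-complement {m} {t} t≤m = ≡-mod (divides (+ 1) (begin
  + t - - + (m ∸ t)  ≡⟨ cong (λ u → + t + u) (ℤ.neg-involutive (+ (m ∸ t))) ⟩
  + t + + (m ∸ t)    ≡⟨ ℤ.pos-+ t (m ∸ t) ⟨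
  + (t ℕ.+ (m ∸ t))  ≡⟨ cong +_ (ℕ.m+[n∸m]≡n t≤m) ⟩
  + m                ≡⟨ ℤ.*-identityˡ (+ m) ⟨
  + 1 * + m          ∎))
  where open ≡-Reasoning

%ℕ-≡-mod : ∀ x m .{{_ : ℕ.NonZero m}} → + (x %ℕ m) ≡ x mod m
%ℕ-≡-mod x m = ≡-mod (divides (- q) (begin
  + r - x                ≡⟨ cong (λ y → + r - y) (a≡a%ℕn+[a/ℕn]*n x m) ⟩
  + r - (+ r + q * + m)  ≡⟨ cancel (+ r) q (+ m) ⟩
  - q * + m              ∎))
  where
  open ≡-Reasoning
  r = x %ℕ m
  q = x /ℕ m
  cancel : ∀ r q m → r - (r + q * m) ≡ - q * m
  cancel = solve-∀

%ℕ≡⇒≡-mod : ∀ x m {r} .{{_ : ℕ.NonZero m}} → x %ℕ m ≡ r → + r ≡ x mod m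
%ℕ≡⇒≡-mod x m refl = %ℕ-≡-mod x m

residue : ∀ m .{{_ : ℕ.NonZero m}} → ℤ → Fin m
residue m x = fromℕ< (n%ℕd<d x m)

residue-≡-mod : ∀ m .{{_ : ℕ.NonZero m}} x → + toℕ (residue m x) ≡ x mod m
residue-≡-mod m x =
  subst (λ r → + r ≡ x mod m) (sym (Fin.toℕ-fromℕ< (n%ℕd<d x m))) (%ℕ-≡-mod x m)

residue-≡⇒≡-mod : ∀ m .{{_ : ℕ.NonZero m}} {x y} → residue m x ≡ residue m y → x ≡ y mod m
residue-≡⇒≡-mod m {x} {y} same = ≡-mod-trans (≡-mod-sym (residue-≡-mod m x))
  (subst (λ r → + toℕ r ≡ y mod m) (sym same) (residue-≡-mod m y))

∣⇒[i/n]*n≡i : ∀ {n} .{{_ : ℕ.NonZero n}} {i} → + n ∣ i → (i / + n) * + n ≡ i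
∣⇒[i/n]*n≡i {n} {i} n∣i = begin
  q * + n        ≡⟨ ℤ.+-identityˡ (q * + n) ⟨
  + 0 + q * + n  ≡⟨ cong (λ r → + r + q * + n) r≡0 ⟨
  + r + q * + n  ≡⟨ a≡a%n+[a/n]*n i (+ n) ⟨
  i              ∎
  where
  open ≡-Reasoning
  r = i % + n
  q = i / + n
  shift : ∀ r x → (r + x) - x ≡ r
  shift = solve-∀
  n∣r : + n ∣ + r
  n∣r = subst (+ n ∣_) (shift (+ r) (q * + n))
    (subst (λ j → + n ∣ j - q * + n) (a≡a%n+[a/n]*n i (+ n)) (∣m∣n⇒∣m-n n∣i (∣n⇒∣m*n q ∣-refl)))
  r≡0 : r ≡ 0
  r≡0 = ∣⇒≡0 (∣⇒∣ᵤ n∣r) (n%d<d i (+ n))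

splitAt-injective : ∀ m {n} {i j : Fin (m ℕ.+ n)} → splitAt m i ≡ splitAt m j → i ≡ j
splitAt-injective m {n} {i} {j} same =
  trans (sym (Fin.join-splitAt m n i)) (trans (cong (join m n) same) (Fin.join-splitAt m n j))

pigeonhole-mod : ∀ {m a b} .{{_ : ℕ.NonZero m}} → m < a ℕ.+ b →
  (f : Fin a → ℤ) → (∀ i j → f i ≡ f j mod m → i ≡ j) →
  (g : Fin b → ℤ) → (∀ i j → g i ≡ g j mod m → i ≡ j) →
  ∃[ i ] ∃[ j ] f i ≡ g j mod m
pigeonhole-mod {m} {a} {b} m<a+b f f-inj g g-inj =
  collide (Fin.pigeonhole m<a+b (residue m ∘ [ f , g ] ∘ splitAt a))
  where
  meet : ∀ s t → s ≢ t → [ f , g ] s ≡ [ f , g ] t mod m → ∃[ i ] ∃[ j ] f i ≡ g j mod m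
  meet (inj₁ i) (inj₁ j) s≢t fi≡fj = contradiction (cong inj₁ (f-inj i j fi≡fj)) s≢t
  meet (inj₁ i) (inj₂ j) _   fi≡gj = i , j , fi≡gj
  meet (inj₂ j) (inj₁ i) _   gj≡fi = i , j , ≡-mod-sym gj≡fi
  meet (inj₂ i) (inj₂ j) s≢t gi≡gj = contradiction (cong inj₂ (g-inj i j gi≡gj)) s≢t
  collide : (∃[ i ] ∃[ j ] i Fin.< j ×
               residue m ([ f , g ] (splitAt a i)) ≡ residue m ([ f , g ] (splitAt a j))) →
            ∃[ i ] ∃[ j ] f i ≡ g j mod m
  collide (i , j , i<j , same) =
    meet (splitAt a i) (splitAt a j) (Fin.<⇒≢ i<j ∘ splitAt-injective a) (residue-≡⇒≡-mod m same)

-- The norm form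

normOK-≡1mod4 : ∀ d a b → d %ℕ 4 ≡ 1 →
  normOK d a b ≡ a * a + a * b + b * b * ((+ 1 - d) / + 4)
normOK-≡1mod4 d a b d≡1 =
  cong (λ c → if c then a * a + a * b + b * b * ((+ 1 - d) / + 4) else a * a - d * b * b)
       (dec-true ((d %ℕ 4) ℕ.≟ 1) d≡1)

normOK-≢1mod4 : ∀ d a b → d %ℕ 4 ≢ 1 → normOK d a b ≡ a * a - d * b * b
normOK-≢1mod4 d a b d≢1 =
  cong (λ c → if c then a * a + a * b + b * b * ((+ 1 - d) / + 4) else a * a - d * b * b)
       (dec-false ((d %ℕ 4) ℕ.≟ 1) d≢1)

4*normOK-≡1mod4 : ∀ d a b → d %ℕ 4 ≡ 1 →
  + 4 * normOK d a b ≡ (+ 2 * a + b) * (+ 2 * a + b) - d * (b * b)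
4*normOK-≡1mod4 d a b d≡1 = begin
  + 4 * normOK d a b                              ≡⟨ cong (+ 4 *_) (normOK-≡1mod4 d a b d≡1) ⟩
  + 4 * (a * a + a * b + b * b * c)               ≡⟨ complete-square a b c ⟩
  (+ 2 * a + b) ² + b * b * (c * + 4 - + 1)       ≡⟨ cong (λ e → (+ 2 * a + b) ² + b * b * (e - + 1)) 4c≡1-d ⟩
  (+ 2 * a + b) ² + b * b * (+ 1 - d - + 1)       ≡⟨ simplify a b d ⟩
  (+ 2 * a + b) ² - d * (b * b)                   ∎
  where
  open ≡-Reasoning
  _² : ℤ → ℤ
  x ² = x * x
  c = (+ 1 - d) / + 4
  4c≡1-d : c * + 4 ≡ + 1 - d
  4c≡1-d = ∣⇒[i/n]*n≡i (∣-difference (%ℕ≡⇒≡-mod d 4 d≡1))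
  complete-square : ∀ a b c →
    + 4 * (a * a + a * b + b * b * c) ≡ (+ 2 * a + b) * (+ 2 * a + b) + b * b * (c * + 4 - + 1)
  complete-square = solve-∀
  simplify : ∀ a b d →
    (+ 2 * a + b) * (+ 2 * a + b) + b * b * (+ 1 - d - + 1) ≡ (+ 2 * a + b) * (+ 2 * a + b) - d * (b * b)
  simplify = solve-∀

4*normOK≡X²-dY² : ∀ d a b → ∃[ X ] ∃[ Y ] + 4 * normOK d a b ≡ X * X - d * (Y * Y)
4*normOK≡X²-dY² d a b with d %ℕ 4 ℕ.≟ 1
... | yes d≡1 = + 2 * a + b , b , 4*normOK-≡1mod4 d a b d≡1
... | no d≢1  = + 2 * a , + 2 * b , trans (cong (+ 4 *_) (normOK-≢1mod4 d a b d≢1)) (double a b d)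
  where
  double : ∀ a b d → + 4 * (a * a - d * b * b) ≡ (+ 2 * a) * (+ 2 * a) - d * ((+ 2 * b) * (+ 2 * b))
  double = solve-∀

a²-db²-isNorm : ∀ d a b → IsNormOK d (a * a - d * b * b)
a²-db²-isNorm d a b with d %ℕ 4 ℕ.≟ 1
... | no d≢1  = a , b , normOK-≢1mod4 d a b d≢1
-- a + b√d = (a - b) + 2b·ω with ω = (1 + √d)/2
... | yes d≡1 = a - b , + 2 * b ,
  ℤ.*-cancelˡ-≡ (+ 4) _ _ (trans (4*normOK-≡1mod4 d (a - b) (+ 2 * b) d≡1) (halve a b d))
  where
  halve : ∀ a b d → (+ 2 * (a - b) + + 2 * b) * (+ 2 * (a - b) + + 2 * b) - d * (+ 2 * b * (+ 2 * b))
                  ≡ + 4 * (a * a - d * b * b)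
  halve = solve-∀

-- The sign of d

-d-isNorm : ∀ d → IsNormOK d (- d)
-d-isNorm d = subst (IsNormOK d) (simplify d) (a²-db²-isNorm d (+ 0) (+ 1))
  where
  simplify : ∀ d → + 0 * + 0 - d * + 1 * + 1 ≡ - d
  simplify = solve-∀

i*i≡+∣i∣*∣i∣ : ∀ i → i * i ≡ + (∣ i ∣ ℕ.* ∣ i ∣)
i*i≡+∣i∣*∣i∣ i = trans (cong (_◃ (∣ i ∣ ℕ.* ∣ i ∣)) (Sign.s*s≡+ (sign i))) (ℤ.+◃n≡+n _)

negative-not-imaginary-norm : ∀ j m → ¬ IsNormOK -[1+ j ] -[1+ m ]
negative-not-imaginary-norm j m (x , y , N≡) with 4*normOK≡X²-dY² -[1+ j ] x y
... | X , Y , 4N≡ = -[1+]≢+ (begin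
  + 4 * -[1+ m ]               ≡⟨ cong (+ 4 *_) N≡ ⟨
  + 4 * normOK -[1+ j ] x y    ≡⟨ 4N≡ ⟩
  X * X - - + suc j * (Y * Y)  ≡⟨ double-negation (X * X) (+ suc j) (Y * Y) ⟩
  X * X + + suc j * (Y * Y)    ≡⟨ cong₂ (λ a b → a + + suc j * b) (i*i≡+∣i∣*∣i∣ X) (i*i≡+∣i∣*∣i∣ Y) ⟩
  + A + + suc j * + B          ≡⟨ cong (λ b → + A + b) (ℤ.pos-* (suc j) B) ⟨
  + A + + (suc j ℕ.* B)        ≡⟨ ℤ.pos-+ A (suc j ℕ.* B) ⟨
  + (A ℕ.+ suc j ℕ.* B)        ∎)
  where
  open ≡-Reasoning
  A = ∣ X ∣ ℕ.* ∣ X ∣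
  B = ∣ Y ∣ ℕ.* ∣ Y ∣
  double-negation : ∀ a c b → a - - c * b ≡ a + c * b
  double-negation = solve-∀
  -[1+]≢+ : ∀ {a b} → -[1+ a ] ≢ + b
  -[1+]≢+ ()

norms-≡⇒sign-≡ : ∀ {d d′} → ∣ d ∣ ≢ 0 → ∣ d′ ∣ ≢ 0 →
  IsNormOK d ⊆ IsNormOK d′ → IsNormOK d′ ⊆ IsNormOK d → sign d ≡ sign d′
norms-≡⇒sign-≡ {+ zero}      d≢0 _    _ _ = contradiction refl d≢0
norms-≡⇒sign-≡ {d′ = + zero} _   d′≢0 _ _ = contradiction refl d′≢0
norms-≡⇒sign-≡ {+ suc _}   {+ suc _}   _ _ _ _ = refl
norms-≡⇒sign-≡ { -[1+ _ ]} { -[1+ _ ]} _ _ _ _ = refl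
norms-≡⇒sign-≡ {+ suc k}   { -[1+ j ]} _ _ ⊆ _ =
  contradiction (⊆ (-d-isNorm (+ suc k))) (negative-not-imaginary-norm j k)
norms-≡⇒sign-≡ { -[1+ j ]} {+ suc k}   _ _ _ ⊇ =
  contradiction (⊇ (-d-isNorm (+ suc k))) (negative-not-imaginary-norm j k)

sign-≡∧∣i∣≡k*∣j∣⇒i≡k*j : ∀ {i j} k → sign i ≡ sign j → ∣ i ∣ ≡ k ℕ.* ∣ j ∣ → i ≡ + k * j
sign-≡∧∣i∣≡k*∣j∣⇒i≡k*j {i} k sign≡ ∣i∣≡ = trans (sym (ℤ.◃-inverse i)) (cong₂ _◃_ sign≡ ∣i∣≡)

-- The prime 2

2∤1 : ¬ (+ 2 ∣ + 1)
2∤1 2∣1 = ℕ.>⇒∤ (ℕ.n<1+n 1) (∣⇒∣ᵤ 2∣1)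

%ℕ4≡1⇒odd : ∀ {d} → d %ℕ 4 ≡ 1 → ¬ (+ 2 ∣ d)
%ℕ4≡1⇒odd {d} d≡1 2∣d = 2∤1 (subst (+ 2 ∣_) (cancel d) (∣m∣n⇒∣m+n 2∣1-d 2∣d))
  where
  cancel : ∀ d → + 1 - d + d ≡ + 1
  cancel = solve-∀
  2∣1-d : + 2 ∣ + 1 - d
  2∣1-d = ∣-trans (divides (+ 2) refl) (∣-difference (%ℕ≡⇒≡-mod d 4 d≡1))

-- abstract, so that the 512-case decision is not unfolded where it is used.
abstract
  odd-mod8-obstruction : ∀ (x y d : Fin 8) →
    let x̄ = + toℕ x ; ȳ = + toℕ y ; d̄ = + toℕ d in
    (+ 2 ∣ d̄) ⊎ ¬ (x̄ * x̄ - + 2 * d̄ * ȳ * ȳ ≡ + 3 * + 3 - d̄ * + 2 * + 2 mod 8)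
  odd-mod8-obstruction = toWitness {a? = Fin.all? λ x → Fin.all? λ y → Fin.all? λ d →
    let x̄ = + toℕ x ; ȳ = + toℕ y ; d̄ = + toℕ d in
    (+ 2 ∣? d̄) ⊎-dec ¬? (≡-mod? (x̄ * x̄ - + 2 * d̄ * ȳ * ȳ) (+ 3 * + 3 - d̄ * + 2 * + 2) 8)} tt

odd⇒x²-2dy²≢9-4d : ∀ x y d → ¬ (+ 2 ∣ d) →
  ¬ (x * x - + 2 * d * y * y ≡ + 3 * + 3 - d * + 2 * + 2 mod 8)
odd⇒x²-2dy²≢9-4d x y d d-odd x²-2dy²≡9-4d
  with odd-mod8-obstruction (residue 8 x) (residue 8 y) (residue 8 d)
... | inj₁ 2∣d̄ = d-odd (subst (+ 2 ∣_) (cancel (+ toℕ (residue 8 d)) d) (∣m∣n⇒∣m-n 2∣d̄ 2∣d̄-d))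
  where
  cancel : ∀ r d → r - (r - d) ≡ d
  cancel = solve-∀
  2∣d̄-d : + 2 ∣ + toℕ (residue 8 d) - d
  2∣d̄-d = ∣-trans (divides (+ 4) refl) (∣-difference (residue-≡-mod 8 d))
... | inj₂ ≢ = ≢ (begin
  x̄ * x̄ - + 2 * d̄ * ȳ * ȳ    ≈⟨ minus-cong-mod (*-cong-mod x̄≡x x̄≡x)
                                  (*-cong-mod (*-cong-mod (*-cong-mod (≡-mod-refl (+ 2)) d̄≡d) ȳ≡y) ȳ≡y) ⟩
  x * x - + 2 * d * y * y      ≈⟨ x²-2dy²≡9-4d ⟩
  + 3 * + 3 - d * + 2 * + 2    ≈⟨ minus-cong-mod (≡-mod-refl (+ 3 * + 3))
                                  (*-cong-mod (*-cong-mod d̄≡d (≡-mod-refl (+ 2))) (≡-mod-refl (+ 2))) ⟨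
  + 3 * + 3 - d̄ * + 2 * + 2    ∎)
  where
  open ≈-Reasoning (≡-mod-setoid {8})
  x̄ = + toℕ (residue 8 x)
  ȳ = + toℕ (residue 8 y)
  d̄ = + toℕ (residue 8 d)
  x̄≡x = residue-≡-mod 8 x
  ȳ≡y = residue-≡-mod 8 y
  d̄≡d = residue-≡-mod 8 d

odd⇒norms-⊈-doubled : ∀ {d} → ¬ (+ 2 ∣ d) → ¬ (IsNormOK d ⊆ IsNormOK (+ 2 * d))
odd⇒norms-⊈-doubled {d} d-odd norms⊆ with norms⊆ (a²-db²-isNorm d (+ 3) (+ 2))
... | x , y , N≡ =
  odd⇒x²-2dy²≢9-4d x y d d-odd (≡⇒≡-mod (trans (sym (normOK-≢1mod4 (+ 2 * d) x y 2d≢1)) N≡))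
  where
  2d≢1 : (+ 2 * d) %ℕ 4 ≢ 1
  2d≢1 2d≡1 = %ℕ4≡1⇒odd 2d≡1 (∣m⇒∣m*n d ∣-refl)

-- Odd primes

euclidsLemmaℤ : ∀ {p} → Prime p → ∀ a b → + p ∣ a * b → (+ p ∣ a) ⊎ (+ p ∣ b)
euclidsLemmaℤ p-prime a b p∣ab =
  Sum.map ∣ᵤ⇒∣ ∣ᵤ⇒∣ (euclidsLemma ∣ a ∣ ∣ b ∣ p-prime (subst (_ ℕ.∣_) (ℤ.abs-* a b) (∣⇒∣ᵤ p∣ab)))

prime[1+2k]⇒1≤k : ∀ {k} → Prime (suc (k ℕ.+ k)) → 1 ≤ k
prime[1+2k]⇒1≤k {zero}  p-prime = contradiction p-prime ¬prime[1]
prime[1+2k]⇒1≤k {suc _} _       = s≤s z≤n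

module OddPrime {k : ℕ} (p-prime : Prime (suc (k ℕ.+ k))) where

  private
    p h : ℕ
    p = suc (k ℕ.+ k)
    h = suc k

    k<p : k < p
    k<p = s≤s (ℕ.m≤m+n k k)

    h<p : h < p
    h<p = s≤s (ℕ.m<m+n k (prime[1+2k]⇒1≤k p-prime))

    p<h+h : p < h ℕ.+ h
    p<h+h = subst (p <_) (cong suc (sym (ℕ.+-suc k k))) (ℕ.n<1+n p)

  square-injective : ∀ {i j} → i ≤ k → j ≤ k → + i * + i ≡ + j * + j mod p → i ≡ j
  square-injective {i} {j} i≤k j≤k (≡-mod p∣i²-j²)
    with euclidsLemmaℤ p-prime (+ i - + j) (+ i + + j) (subst (+ p ∣_) (factor (+ i) (+ j)) p∣i²-j²)
    where
    factor : ∀ a b → a * a - b * b ≡ (a - b) * (a + b)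
    factor = solve-∀
  ... | inj₁ p∣i-j = ≡-mod⇒≡ (ℕ.≤-<-trans i≤k k<p) (ℕ.≤-<-trans j≤k k<p) (≡-mod p∣i-j)
  ... | inj₂ p∣i+j = trans (ℕ.m+n≡0⇒m≡0 i i+j≡0) (sym (ℕ.m+n≡0⇒n≡0 i i+j≡0))
    where
    i+j≡0 : i ℕ.+ j ≡ 0
    i+j≡0 = ∣⇒≡0 (∣⇒∣ᵤ p∣i+j) (s≤s (ℕ.+-mono-≤ i≤k j≤k))

  square≡small-square : ∀ X → ∃[ u ] u ≤ k × X * X ≡ + u * + u mod p
  square≡small-square X = fold (X %ℕ p) (n%ℕd<d X p) (≡-mod-sym (%ℕ-≡-mod X p))
    where
    fold : ∀ t → t < p → X ≡ + t mod p → ∃[ u ] u ≤ k × X * X ≡ + u * + u mod p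
    fold t t<p X≡t with t ℕ.≤? k
    ... | yes t≤k = t , t≤k , *-cong-mod X≡t X≡t
    ... | no t≰k  = p ∸ t , p∸t≤k , (begin
      X * X                      ≈⟨ *-cong-mod X≡-u X≡-u ⟩
      - + (p ∸ t) * - + (p ∸ t)  ≡⟨ neg-square (+ (p ∸ t)) ⟩
      + (p ∸ t) * + (p ∸ t)      ∎)
      where
      open ≈-Reasoning (≡-mod-setoid {p})
      neg-square : ∀ a → - a * - a ≡ a * a
      neg-square = solve-∀
      p∸t≤k : p ∸ t ≤ k
      p∸t≤k = ℕ.≤-trans (ℕ.∸-monoʳ-≤ p (ℕ.≰⇒> t≰k)) (ℕ.≤-reflexive (ℕ.m+n∸n≡m k k))
      X≡-u : X ≡ - + (p ∸ t) mod p
      X≡-u = ≡-mod-trans X≡t (≡-mod-neg-complement (ℕ.<⇒≤ t<p))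

  -- The h residues u² and the h residues r + cv² (u, v < h) are pairwise distinct, and 2h > p.
  every-residue-a²-cb² : ∀ {c} → ¬ (+ p ∣ c) → ∀ r → ∃[ a ] ∃[ b ] a * a - c * b * b ≡ r mod p
  every-residue-a²-cb² {c} p∤c r =
    conclude (pigeonhole-mod p<h+h square square-inj shifted shifted-inj)
    where
    square : Fin h → ℤ
    square u = + toℕ u * + toℕ u
    square-inj : ∀ u v → square u ≡ square v mod p → u ≡ v
    square-inj u v = Fin.toℕ-injective ∘ square-injective (Fin.toℕ≤pred[n] u) (Fin.toℕ≤pred[n] v)
    shifted : Fin h → ℤ
    shifted v = r + c * square v
    factor : ∀ r c a b → (r + c * a) - (r + c * b) ≡ c * (a - b)
    factor = solve-∀
    shifted-inj : ∀ u v → shifted u ≡ shifted v mod p → u ≡ v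
    shifted-inj u v (≡-mod p∣Δ)
      with euclidsLemmaℤ p-prime c _ (subst (+ p ∣_) (factor r c (square u) (square v)) p∣Δ)
    ... | inj₁ p∣c     = contradiction p∣c p∤c
    ... | inj₂ p∣u²-v² = square-inj u v (≡-mod p∣u²-v²)
    rearrange : ∀ r c a b → a * a - (r + c * (b * b)) ≡ a * a - c * b * b - r
    rearrange = solve-∀
    conclude : ∃[ u ] ∃[ v ] square u ≡ shifted v mod p → ∃[ a ] ∃[ b ] a * a - c * b * b ≡ r mod p
    conclude (u , v , ≡-mod p∣u²-[r+cv²]) =
      + toℕ u , + toℕ v , ≡-mod (subst (+ p ∣_) (rearrange r c (+ toℕ u) (+ toℕ v)) p∣u²-[r+cv²])

  private module Roots (sqrt : ∀ r → ∃[ X ] X * X ≡ r mod p) where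

    small-root : ∀ r → ∃[ u ] + toℕ u * + toℕ u ≡ r mod p
    small-root r =
      let X , X²≡r = sqrt r
          u , u≤k , X²≡u² = square≡small-square X
      in fromℕ< (s≤s u≤k) ,
         subst (λ n → + n * + n ≡ r mod p) (sym (Fin.toℕ-fromℕ< (s≤s u≤k)))
           (≡-mod-trans (≡-mod-sym X²≡u²) X²≡r)

    root : Fin p → Fin h
    root r = proj₁ (small-root (+ toℕ r))

    root-injective : ∀ r s → root r ≡ root s → r ≡ s
    root-injective r s same = Fin.toℕ-injective (≡-mod⇒≡ (Fin.toℕ<n r) (Fin.toℕ<n s) (begin
      + toℕ r                          ≈⟨ proj₂ (small-root (+ toℕ r)) ⟨
      + toℕ (root r) * + toℕ (root r)  ≡⟨ cong (λ u → + toℕ u * + toℕ u) same ⟩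
      + toℕ (root s) * + toℕ (root s)  ≈⟨ proj₂ (small-root (+ toℕ s)) ⟩
      + toℕ s                          ∎))
      where open ≈-Reasoning (≡-mod-setoid {p})

  -- Every square is ≡ u² for some u < h, so at most h < p residues are squares.
  not-every-residue-square : ¬ (∀ r → ∃[ X ] X * X ≡ r mod p)
  not-every-residue-square sqrt = collide (Fin.pigeonhole h<p root)
    where
    open Roots sqrt
    collide : (∃[ r ] ∃[ s ] r Fin.< s × root r ≡ root s) → ⊥
    collide (r , s , r<s , same) = Fin.<⇒≢ r<s (root-injective r s same)

  -- 2h = p + 1, so 4h² ≡ 1 mod p.
  4h²r≡r : ∀ r → + 4 * (+ h * + h * r) ≡ r mod p
  4h²r≡r r = ≡-mod (divides ((+ 2 * + k + + 3) * r) (identity (+ k) r))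
    where
    identity : ∀ k r → + 4 * ((+ 1 + k) * (+ 1 + k) * r) - r ≡ (+ 2 * k + + 3) * r * (+ 1 + (k + k))
    identity = solve-∀

  4*norm≡square : ∀ {c n} → + p ∣ c → IsNormOK c n → ∃[ X ] X * X ≡ + 4 * n mod p
  4*norm≡square {c} {n} p∣c (x , y , N≡n) =
    let X , Y , 4N≡ = 4*normOK≡X²-dY² c x y
    in X , (begin
      X * X                ≈⟨ drop-multiple (X * X) (c * (Y * Y)) (∣m⇒∣m*n (Y * Y) p∣c) ⟨
      X * X - c * (Y * Y)  ≡⟨ 4N≡ ⟨
      + 4 * normOK c x y   ≡⟨ cong (+ 4 *_) N≡n ⟩
      + 4 * n              ∎)
    where
    open ≈-Reasoning (≡-mod-setoid {p})
    cancel : ∀ a b → a - b - a ≡ - b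
    cancel = solve-∀
    drop-multiple : ∀ a b → + p ∣ b → a - b ≡ a mod p
    drop-multiple a b p∣b = ≡-mod (subst (+ p ∣_) (sym (cancel a b)) (∣m⇒∣-m p∣b))

  ∤∣⇒norms-⊈ : ∀ {c c′} → ¬ (+ p ∣ c) → + p ∣ c′ → ¬ (IsNormOK c ⊆ IsNormOK c′)
  ∤∣⇒norms-⊈ {c} {c′} p∤c p∣c′ norms⊆ = not-every-residue-square every-residue-square
    where
    open ≈-Reasoning (≡-mod-setoid {p})
    every-residue-square : ∀ r → ∃[ X ] X * X ≡ r mod p
    every-residue-square r =
      let a , b , a²-cb²≡h²r = every-residue-a²-cb² p∤c (+ h * + h * r)
          X , X²≡4[a²-cb²] = 4*norm≡square p∣c′ (norms⊆ (a²-db²-isNorm c a b))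
      in X , (begin
        X * X                      ≈⟨ X²≡4[a²-cb²] ⟩
        + 4 * (a * a - c * b * b)  ≈⟨ *-cong-mod (≡-mod-refl (+ 4)) a²-cb²≡h²r ⟩
        + 4 * (+ h * + h * r)      ≈⟨ 4h²r≡r r ⟩
        r                          ∎)

even⊎odd : ∀ n → ∃[ k ] (n ≡ k ℕ.+ k ⊎ n ≡ suc (k ℕ.+ k))
even⊎odd zero = 0 , inj₁ refl
even⊎odd (suc n) with even⊎odd n
... | k , inj₁ n≡2k   = k , inj₂ (cong suc n≡2k)
... | k , inj₂ n≡1+2k = suc k , inj₁ (trans (cong suc n≡1+2k) (cong suc (sym (ℕ.+-suc k k))))

odd-prime≡1+2k : ∀ {p} → Prime p → p ≢ 2 → ∃[ k ] p ≡ suc (k ℕ.+ k)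
odd-prime≡1+2k {p} p-prime p≢2 with even⊎odd p
... | k , inj₂ p≡1+2k = k , p≡1+2k
... | k , inj₁ p≡2k with prime⇒irreducible p-prime (ℕ.divides k (trans p≡2k (double k)))
  where
  double : ∀ k → k ℕ.+ k ≡ k ℕ.* 2
  double k = trans (cong (k ℕ.+_) (sym (ℕ.+-identityʳ k))) (ℕ.*-comm 2 k)
...   | inj₁ ()
...   | inj₂ 2≡p = contradiction (sym 2≡p) p≢2

odd-prime-∤∣⇒norms-⊈ : ∀ {p c c′} → Prime p → p ≢ 2 → ¬ (+ p ∣ c) → + p ∣ c′ →
  ¬ (IsNormOK c ⊆ IsNormOK c′)
odd-prime-∤∣⇒norms-⊈ p-prime p≢2 with odd-prime≡1+2k p-prime p≢2
... | k , refl = OddPrime.∤∣⇒norms-⊈ {k} p-prime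

-- Comparing |d| and |d′|

prime-divisor : ∀ {n} → n ≢ 1 → PrimeFactorisation n → ∃[ p ] Prime p × p ℕ.∣ n
prime-divisor n≢1 record { factors = [] ; isFactorisation = n≡1 } = contradiction n≡1 n≢1
prime-divisor _ record { factors = p ∷ ps ; isFactorisation = n≡p*ps ; factorsPrime = p-prime ∷ _ } =
  p , p-prime , subst (p ℕ.∣_) (sym n≡p*ps) (ℕ.m∣m*n (product ps))

squarefree-2-power≡1⊎2 : ∀ {u} → (∀ n → n ℕ.* n ℕ.∣ u → n ≡ 1) →
  (∀ {p} → Prime p → p ℕ.∣ u → p ≡ 2) → u ≡ 1 ⊎ u ≡ 2
squarefree-2-power≡1⊎2 {u} sf only-2 with u ℕ.≟ 1
... | yes u≡1 = inj₁ u≡1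
... | no u≢1  = inj₂ (trans (ℕ._∣_.equality 2∣u) (cong (ℕ._* 2) v≡1))
  where
  4∤ : ∀ {w} → w ℕ.∣ u → ¬ (4 ℕ.∣ w)
  4∤ w∣u 4∣w with sf 2 (ℕ.∣-trans 4∣w w∣u)
  ... | ()
  nonZero : ∀ {w} → w ℕ.∣ u → ℕ.NonZero w
  nonZero {zero}  w∣u = contradiction (4 ℕ.∣0) (4∤ w∣u)
  nonZero {suc w} _   = _
  2∣ : ∀ {w} → w ℕ.∣ u → w ≢ 1 → 2 ℕ.∣ w
  2∣ {w} w∣u w≢1 =
    let p , p-prime , p∣w = prime-divisor w≢1 (factorise w {{nonZero w∣u}})
    in subst (ℕ._∣ w) (only-2 p-prime (ℕ.∣-trans p∣w w∣u)) p∣w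
  2∣u : 2 ℕ.∣ u
  2∣u = 2∣ ℕ.∣-refl u≢1
  v = ℕ._∣_.quotient 2∣u
  v∣u : v ℕ.∣ u
  v∣u = ℕ.divides 2 (trans (ℕ._∣_.equality 2∣u) (ℕ.*-comm v 2))
  v≡1 : v ≡ 1
  v≡1 with v ℕ.≟ 1
  ... | yes v≡1 = v≡1
  ... | no v≢1  = contradiction
    (subst (4 ℕ.∣_) (sym (ℕ._∣_.equality 2∣u)) (ℕ.*-pres-∣ (2∣ v∣u v≢1) (ℕ.∣-refl {2})))
    (4∤ ℕ.∣-refl)

squarefree⇒∣∣≢0 : ∀ {d} → SquareFree d → ∣ d ∣ ≢ 0
squarefree⇒∣∣≢0 sf ∣d∣≡0 with sf 2 (subst (4 ℕ.∣_) (sym ∣d∣≡0) (4 ℕ.∣0))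
... | ()

squarefree[2d]⇒odd : ∀ {d} → SquareFree (+ 2 * d) → ¬ (+ 2 ∣ d)
squarefree[2d]⇒odd {d} sf 2∣d
  with sf 2 (subst (4 ℕ.∣_) (sym (ℤ.abs-* (+ 2) d)) (ℕ.*-pres-∣ (ℕ.∣-refl {2}) (∣⇒∣ᵤ 2∣d)))
... | ()

norms-⊇⇒cofactor-1-or-2 : ∀ {d d′ u} → SquareFree d → IsNormOK d′ ⊆ IsNormOK d →
  ∣ d ∣ ≡ u ℕ.* gcd ∣ d ∣ ∣ d′ ∣ → u ≡ 1 ⊎ u ≡ 2
norms-⊇⇒cofactor-1-or-2 {d} {d′} {u} sf norms⊆ ∣d∣≡ug =
  squarefree-2-power≡1⊎2 (λ n n²∣u → sf n (ℕ.∣-trans n²∣u u∣d)) only-2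
  where
  u∣d : u ℕ.∣ ∣ d ∣
  u∣d = ℕ.divides (gcd ∣ d ∣ ∣ d′ ∣) (trans ∣d∣≡ug (ℕ.*-comm u _))
  only-2 : ∀ {p} → Prime p → p ℕ.∣ u → p ≡ 2
  only-2 {p} p-prime p∣u with p ℕ.≟ 2
  ... | yes p≡2 = p≡2
  ... | no p≢2  =
    ⊥-elim (odd-prime-∤∣⇒norms-⊈ {c′ = d} p-prime p≢2 p∤d′ (∣ᵤ⇒∣ (ℕ.∣-trans p∣u u∣d)) norms⊆)
    where
    p∤d′ : ¬ (+ p ∣ d′)
    p∤d′ p∣d′ = ¬prime[1] (subst Prime (sf p p²∣d) p-prime)
      where
      p²∣d : p ℕ.* p ℕ.∣ ∣ d ∣
      p²∣d = subst (p ℕ.* p ℕ.∣_) (sym ∣d∣≡ug)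
        (ℕ.*-pres-∣ p∣u (gcd-greatest (ℕ.∣-trans p∣u u∣d) (∣⇒∣ᵤ p∣d′)))

cofactors-1-or-2⇒ratio-1-or-2 : ∀ {m n} → m ≢ 0 →
  (∀ {u} → m ≡ u ℕ.* gcd m n → u ≡ 1 ⊎ u ≡ 2) → (∀ {v} → n ≡ v ℕ.* gcd n m → v ≡ 1 ⊎ v ≡ 2) →
  m ≡ 1 ℕ.* n ⊎ m ≡ 2 ℕ.* n ⊎ n ≡ 2 ℕ.* m
cofactors-1-or-2⇒ratio-1-or-2 {m} {n} m≢0 u-small v-small =
  cases {u} {v} m≡ug n≡vg (u-small m≡ug) (v-small (trans n≡vg (cong (v ℕ.*_) (gcd-comm m n))))
  where
  g = gcd m n
  u = ℕ._∣_.quotient (gcd[m,n]∣m m n)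
  v = ℕ._∣_.quotient (gcd[m,n]∣n m n)
  m≡ug : m ≡ u ℕ.* g
  m≡ug = ℕ._∣_.equality (gcd[m,n]∣m m n)
  n≡vg : n ≡ v ℕ.* g
  n≡vg = ℕ._∣_.equality (gcd[m,n]∣n m n)
  2g∣g⇒g≡0 : ∀ {g} → 2 ℕ.* g ℕ.∣ g → g ≡ 0
  2g∣g⇒g≡0 {zero}  _    = refl
  2g∣g⇒g≡0 {suc g} 2g∣g = contradiction (ℕ.∣⇒≤ 2g∣g) (ℕ.<⇒≱ (ℕ.m<m+n (suc g) (s≤s z≤n)))
  cases : ∀ {u v} → m ≡ u ℕ.* g → n ≡ v ℕ.* g → u ≡ 1 ⊎ u ≡ 2 → v ≡ 1 ⊎ v ≡ 2 →
    m ≡ 1 ℕ.* n ⊎ m ≡ 2 ℕ.* n ⊎ n ≡ 2 ℕ.* m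
  cases m≡g  n≡g  (inj₁ refl) (inj₁ refl) =
    inj₁ (trans m≡g (cong (1 ℕ.*_) (trans (sym (ℕ.*-identityˡ g)) (sym n≡g))))
  cases m≡2g n≡g  (inj₂ refl) (inj₁ refl) =
    inj₂ (inj₁ (trans m≡2g (cong (2 ℕ.*_) (trans (sym (ℕ.*-identityˡ g)) (sym n≡g)))))
  cases m≡g  n≡2g (inj₁ refl) (inj₂ refl) =
    inj₂ (inj₂ (trans n≡2g (cong (2 ℕ.*_) (trans (sym (ℕ.*-identityˡ g)) (sym m≡g)))))
  cases m≡2g n≡2g (inj₂ refl) (inj₂ refl) = contradiction (trans m≡2g (cong (2 ℕ.*_) (2g∣g⇒g≡0 2g∣g))) m≢0
    where
    2g∣g : 2 ℕ.* g ℕ.∣ g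
    2g∣g = gcd-greatest (ℕ.∣-reflexive (sym m≡2g)) (ℕ.∣-reflexive (sym n≡2g))

norms-≡⇒abs-ratio-1-or-2 : ∀ {d d′} → SquareFree d → SquareFree d′ →
  IsNormOK d ⊆ IsNormOK d′ → IsNormOK d′ ⊆ IsNormOK d →
  ∣ d ∣ ≡ 1 ℕ.* ∣ d′ ∣ ⊎ ∣ d ∣ ≡ 2 ℕ.* ∣ d′ ∣ ⊎ ∣ d′ ∣ ≡ 2 ℕ.* ∣ d ∣
norms-≡⇒abs-ratio-1-or-2 {d} {d′} sf sf′ norms⊆ norms⊇ =
  cofactors-1-or-2⇒ratio-1-or-2 (squarefree⇒∣∣≢0 {d} sf)
    (norms-⊇⇒cofactor-1-or-2 {d} {d′} sf norms⊇) (norms-⊇⇒cofactor-1-or-2 {d′} {d} sf′ norms⊆)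

∣d∣≡2∣d′∣⇒norms-⊈ : ∀ {d d′} → SquareFree d → sign d ≡ sign d′ → ∣ d ∣ ≡ 2 ℕ.* ∣ d′ ∣ →
  ¬ (IsNormOK d′ ⊆ IsNormOK d)
∣d∣≡2∣d′∣⇒norms-⊈ {d} {d′} sf sign≡ ∣d∣≡2∣d′∣ =
  subst (λ e → ¬ (IsNormOK d′ ⊆ IsNormOK e)) (sym d≡2d′)
    (odd⇒norms-⊈-doubled (squarefree[2d]⇒odd {d′} (subst SquareFree d≡2d′ sf)))
  where
  d≡2d′ : d ≡ + 2 * d′
  d≡2d′ = sign-≡∧∣i∣≡k*∣j∣⇒i≡k*j 2 sign≡ ∣d∣≡2∣d′∣

corollary1p7 : (d d′ : ℤ) → QuadraticFieldParam d → QuadraticFieldParam d′ →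
    ((n : ℤ) → (IsNormOK d n → IsNormOK d′ n) × (IsNormOK d′ n → IsNormOK d n)) →
    d ≡ d′
corollary1p7 d d′ (sf , _) (sf′ , _) same-norms =
  conclude (norms-≡⇒abs-ratio-1-or-2 {d} {d′} sf sf′ norms⊆ norms⊇)
  where
  norms⊆ : IsNormOK d ⊆ IsNormOK d′
  norms⊆ {n} = proj₁ (same-norms n)
  norms⊇ : IsNormOK d′ ⊆ IsNormOK d
  norms⊇ {n} = proj₂ (same-norms n)
  sign≡ : sign d ≡ sign d′
  sign≡ = norms-≡⇒sign-≡ (squarefree⇒∣∣≢0 {d} sf) (squarefree⇒∣∣≢0 {d′} sf′) norms⊆ norms⊇
  conclude : ∣ d ∣ ≡ 1 ℕ.* ∣ d′ ∣ ⊎ ∣ d ∣ ≡ 2 ℕ.* ∣ d′ ∣ ⊎ ∣ d′ ∣ ≡ 2 ℕ.* ∣ d ∣ → d ≡ d′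
  conclude (inj₁ ∣d∣≡∣d′∣) =
    trans (sign-≡∧∣i∣≡k*∣j∣⇒i≡k*j {d} {d′} 1 sign≡ ∣d∣≡∣d′∣) (ℤ.*-identityˡ d′)
  conclude (inj₂ (inj₁ ∣d∣≡2∣d′∣)) =
    ⊥-elim (∣d∣≡2∣d′∣⇒norms-⊈ {d} {d′} sf sign≡ ∣d∣≡2∣d′∣ norms⊇)
  conclude (inj₂ (inj₂ ∣d′∣≡2∣d∣)) =
    ⊥-elim (∣d∣≡2∣d′∣⇒norms-⊈ {d′} {d} sf′ (sym sign≡) ∣d′∣≡2∣d∣ norms⊆)
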